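{- Let $G$ be a graph such that each vertex of $G$ belongs to exactly one simplex of $G$ and every simplex of $G$ contains at least two simplicial vertices. Then $G$ belongs to the class $\mathbf{W}_2$.
   Context: Graphs are finite, simple, undirected, with non-empty vertex set. A vertex $v$ is simplicial if the subgraph induced by its closed neighborhood $N[v]=N(v)\cup\{v\}$ is complete; this complete subgraph (equivalently the vertex set $N[v]$) is called a simplex of $G$. An independent set is a set of pairwise non-adjacent vertices; a maximum independent set is one of largest size. A graph belongs to $\mathbf{W}_2$ if every two disjoint independent sets are included, respectively, in two disjoint maximum independent sets. -}

module Defs where

open import Data.Nat using (ℕ; _≤_; NonZero)
open import Data.Fin using (Fin)
open import Data.Fin.Subset using (Subset; _∈_; _∉_; _⊆_; ∣_∣)
open import Data.Product using (Σ; ∃; ∃-syntax; _×_)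
open import Data.Sum using (_⊎_)
open import Data.Empty using (⊥)
open import Relation.Nullary using (¬_; Dec)
open import Relation.Binary.PropositionalEquality using (_≡_; _≢_)

-- A finite simple undirected graph on vertex set Fin n
-- (adjacency is decidable, as it is for any finite graph).
record Graph (n : ℕ) : Set₁ where
  field
    Adj     : Fin n → Fin n → Set
    adj?    : ∀ x y → Dec (Adj x y)
    sym     : ∀ {x y} → Adj x y → Adj y x
    irrefl  : ∀ {x} → ¬ Adj x x

module _ {n : ℕ} (G : Graph n) where
  open Graph G

  InClosedNbhd : Fin n → Fin n → Set
  InClosedNbhd v u = u ≡ v ⊎ Adj v u

  Simplicial : Fin n → Set
  Simplicial v = ∀ x y → InClosedNbhd v x → InClosedNbhd v y → x ≢ y → Adj x y

  IsSimplex : Subset n → Set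
  IsSimplex S = ∃[ v ] (Simplicial v × (∀ u → (u ∈ S → InClosedNbhd v u) × (InClosedNbhd v u → u ∈ S)))

  Independent : Subset n → Set
  Independent S = ∀ x y → x ∈ S → y ∈ S → ¬ Adj x y

  MaximumIndependent : Subset n → Set
  MaximumIndependent S = Independent S × (∀ T → Independent T → ∣ T ∣ ≤ ∣ S ∣)

  Disjoint : Subset n → Subset n → Set
  Disjoint A B = ∀ x → x ∈ A → x ∉ B

  InW₂ : Set
  InW₂ = ∀ A B → Independent A → Independent B → Disjoint A B →
         ∃[ S ] ∃[ T ] (MaximumIndependent S × MaximumIndependent T ×
                        A ⊆ S × B ⊆ T × Disjoint S T)

  EachVertexInUniqueSimplex : Set
  EachVertexInUniqueSimplex =
    ∀ u → (∃[ S ] (IsSimplex S × u ∈ S)) ×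
          (∀ S T → IsSimplex S → IsSimplex T → u ∈ S → u ∈ T → S ≡ T)

  SimplicesHaveTwoSimplicial : Set
  SimplicesHaveTwoSimplicial =
    ∀ S → IsSimplex S → ∃[ a ] ∃[ b ] (a ≢ b × a ∈ S × b ∈ S × Simplicial a × Simplicial b)

-- The simplices partition the vertices, and an independent set meets each simplex at
-- most once; so a set choosing one vertex from every simplex is at least as large as any
-- independent set.  Such a choice is independent as soon as each chosen vertex either lies
-- in a fixed independent set X or is simplicial, because all neighbours of a simplicial
-- vertex lie in its own simplex.  For S, choose in each simplex its vertex in A if there
-- is one, and otherwise a simplicial vertex outside B; for T, its vertex in B if there is
-- one, and otherwise a simplicial vertex other than the one chosen for S.  Both fallbacks
-- exist because every simplex has two simplicial vertices and B meets it at most once,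
-- and they keep S and T disjoint.

module Submission where

open import Defs

open import Data.Nat using (ℕ; NonZero; suc; _≤_; z≤n; s≤s)
open import Data.Nat.Properties using (module ≤-Reasoning)
open import Data.Fin using (Fin; zero; suc; _≟_)
open import Data.Fin.Properties using (any?; all?)
open import Data.Fin.Subset using (Subset; _∈_; _∉_; _⊆_; _⊂_; _-_; ∣_∣; inside; outside)
open import Data.Fin.Subset.Properties
  using (_∈?_; p─⊥≡p; nonempty?; Empty-unique; ∣⊥∣≡0; x∈p⇒p-x⊂p; p─q⊆p; x∈p∧x≢y⇒x∈p-y)
open import Data.Fin.Subset.Induction using (⊂-wellFounded; Acc; acc)
open import Data.Vec using (_∷_; here; there; tabulate)
open import Data.Vec.Properties using (lookup∘tabulate; lookup⇒[]=; []=⇒lookup)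
open import Data.Product using (_×_; _,_; proj₁; proj₂)
open import Data.Sum using (_⊎_; inj₁; inj₂)
open import Data.Empty using (⊥-elim)
open import Level using (Level; 0ℓ)
open import Relation.Nullary using (¬_; yes; no; does)
open import Relation.Nullary.Decidable using (dec-true; _×-dec_; _⊎-dec_; _→-dec_; ¬?)
open import Relation.Unary using (Pred; Decidable)
open import Relation.Binary.PropositionalEquality
  using (_≡_; _≢_; refl; sym; trans; cong; subst; module ≡-Reasoning)

private
  variable
    ℓ : Level
    m n : ℕ

toSubset : {P : Pred (Fin n) ℓ} → Decidable P → Subset n
toSubset P? = tabulate (λ x → does (P? x))

module _ {P : Pred (Fin n) ℓ} (P? : Decidable P) {x : Fin n} where

  ∈-toSubset⁺ : P x → x ∈ toSubset P?
  ∈-toSubset⁺ px = lookup⇒[]= x _ (trans (lookup∘tabulate _ x) (dec-true (P? x) px))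

  ∈-toSubset⁻ : x ∈ toSubset P? → P x
  ∈-toSubset⁻ x∈ with P? x | trans (sym (lookup∘tabulate _ x)) ([]=⇒lookup x∈)
  ... | yes px | _  = px
  ... | no _   | ()

∣p∣≡1+∣p-x∣ : {p : Subset n} {x : Fin n} → x ∈ p → ∣ p ∣ ≡ suc ∣ p - x ∣
∣p∣≡1+∣p-x∣ {p = inside ∷ p} here = cong suc (cong ∣_∣ (sym (p─⊥≡p p)))
∣p∣≡1+∣p-x∣ {p = inside  ∷ p} (there x∈p) = cong suc (∣p∣≡1+∣p-x∣ x∈p)
∣p∣≡1+∣p-x∣ {p = outside ∷ p} (there x∈p) = ∣p∣≡1+∣p-x∣ x∈p

x∉p-x : {p : Subset n} (x : Fin n) → x ∉ p - x
x∉p-x {p = _ ∷ _} zero    ()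
x∉p-x {p = _ ∷ _} (suc x) (there x∈p-x) = x∉p-x x x∈p-x

injectiveOn⇒∣p∣≤∣q∣ : (f : Fin m → Fin n) {p : Subset m} {q : Subset n} →
  (∀ {x} → x ∈ p → f x ∈ q) → (∀ {x y} → x ∈ p → y ∈ p → f x ≡ f y → x ≡ y) →
  ∣ p ∣ ≤ ∣ q ∣
injectiveOn⇒∣p∣≤∣q∣ {m} f = go (⊂-wellFounded _)
  where
  go : {p : Subset _} {q : Subset _} → Acc _⊂_ p →
       (∀ {x} → x ∈ p → f x ∈ q) → (∀ {x y} → x ∈ p → y ∈ p → f x ≡ f y → x ≡ y) →
       ∣ p ∣ ≤ ∣ q ∣
  go {p} {q} (acc rec) maps inj with nonempty? p
  ... | no ∄x = subst (_≤ ∣ q ∣) (sym (trans (cong ∣_∣ (Empty-unique ∄x)) (∣⊥∣≡0 m))) z≤n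
  ... | yes (x , x∈p) = begin
    ∣ p ∣            ≡⟨ ∣p∣≡1+∣p-x∣ x∈p ⟩
    suc ∣ p - x ∣    ≤⟨ s≤s (go (rec (x∈p⇒p-x⊂p x∈p)) maps′ inj′) ⟩
    suc ∣ q - f x ∣  ≡⟨ sym (∣p∣≡1+∣p-x∣ (maps x∈p)) ⟩
    ∣ q ∣            ∎
    where
    open ≤-Reasoning
    ∈p : ∀ {y} → y ∈ p - x → y ∈ p
    ∈p = p─q⊆p _ _
    maps′ : ∀ {y} → y ∈ p - x → f y ∈ q - f x
    maps′ {y} y∈ = x∈p∧x≢y⇒x∈p-y (maps (∈p y∈))
      (λ fy≡fx → x∉p-x x (subst (_∈ p - x) (inj (∈p y∈) x∈p fy≡fx) y∈))
    inj′ : ∀ {y z} → y ∈ p - x → z ∈ p - x → f y ≡ f z → y ≡ z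
    inj′ y∈ z∈ = inj (∈p y∈) (∈p z∈)

module _ {n : ℕ} (G : Graph n) where
  open Graph G renaming (sym to Adj-sym)

  private
    variable
      C X : Subset n
      u v x y : Fin n

  simplicial? : Decidable (Simplicial G)
  simplicial? v = all? λ x → all? λ y →
    inN? x →-dec inN? y →-dec ¬? (x ≟ y) →-dec adj? x y
    where
    inN? : Decidable (InClosedNbhd G v)
    inN? u = (u ≟ v) ⊎-dec adj? v u

  simplex-adjacent : IsSimplex G C → x ∈ C → y ∈ C → x ≢ y → Adj x y
  simplex-adjacent (c , c-simplicial , C≡N[c]) x∈C y∈C =
    c-simplicial _ _ (proj₁ (C≡N[c] _) x∈C) (proj₁ (C≡N[c] _) y∈C)

  independent-simplex-unique : IsSimplex G C → Independent G X →
    x ∈ C → y ∈ C → x ∈ X → y ∈ X → x ≡ y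
  independent-simplex-unique {x = x} {y = y} C-simplex X-independent x∈C y∈C x∈X y∈X
    with x ≟ y
  ... | yes x≡y = x≡y
  ... | no x≢y  = ⊥-elim (X-independent x y x∈X y∈X (simplex-adjacent C-simplex x∈C y∈C x≢y))

  -- C = N[c]; for u ≠ c, simpliciality of u makes c adjacent to every other neighbour v of u.
  simplicial-neighbour-∈ : IsSimplex G C → u ∈ C → Simplicial G u → Adj u v → v ∈ C
  simplicial-neighbour-∈ {u = u} {v = v} (c , _ , C≡N[c]) u∈C u-simplicial u~v
    with proj₁ (C≡N[c] u) u∈C
  ... | inj₁ refl = proj₂ (C≡N[c] v) (inj₂ u~v)
  ... | inj₂ c~u with c ≟ v
  ...   | yes refl = proj₂ (C≡N[c] v) (inj₁ refl)
  ...   | no c≢v   =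
    proj₂ (C≡N[c] v) (inj₂ (u-simplicial c v (inj₂ (Adj-sym c~u)) (inj₂ u~v) c≢v))

  record IsRepresentative (X : Subset n) (P : Pred (Fin n) 0ℓ) (C : Subset n) (r : Fin n) :
    Set where
    field
      ∈C           : r ∈ C
      ∈X⊎simplicial : r ∈ X ⊎ (Simplicial G r × ¬ P r)
      ∈X-if-meets  : x ∈ C → x ∈ X → r ∈ X

  Represents : Subset n → (Subset n → Pred (Fin n) 0ℓ) → (Subset n → Fin n) → Set
  Represents X P r = ∀ {C} → IsSimplex G C → IsRepresentative X (P C) C (r C)

  -- The default is only returned when C is not a simplex.
  pick : (X : Subset n) {P : Pred (Fin n) 0ℓ} → Decidable P → Fin n → Subset n → Fin n
  pick X P? default C with any? (λ x → (x ∈? C) ×-dec (x ∈? X))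
  ... | yes (x , _) = x
  ... | no _ with any? (λ x → (x ∈? C) ×-dec simplicial? x ×-dec ¬? (P? x))
  ...   | yes (x , _) = x
  ...   | no _        = default

  pick-isRepresentative : SimplicesHaveTwoSimplicial G → IsSimplex G C →
    {P : Pred (Fin n) 0ℓ} (P? : Decidable P) (default : Fin n) →
    (∀ {x y} → x ∈ C → y ∈ C → P x → P y → x ≡ y) →
    IsRepresentative X P C (pick X P? default C)
  pick-isRepresentative {C = C} {X = X} two-simplicial C-simplex P? default P-unique
    with any? (λ x → (x ∈? C) ×-dec (x ∈? X))
  ... | yes (x , x∈C , x∈X) = record
    { ∈C = x∈C ; ∈X⊎simplicial = inj₁ x∈X ; ∈X-if-meets = λ _ _ → x∈X }
  ... | no C∩X≡∅ with any? (λ x → (x ∈? C) ×-dec simplicial? x ×-dec ¬? (P? x))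
  ...   | yes (x , x∈C , good) = record
    { ∈C = x∈C
    ; ∈X⊎simplicial = inj₂ good
    ; ∈X-if-meets = λ y∈C y∈X → ⊥-elim (C∩X≡∅ (_ , y∈C , y∈X))
    }
  ...   | no ∄good with two-simplicial C C-simplex
  ...     | a , b , a≢b , a∈C , b∈C , a-simplicial , b-simplicial with P? a | P? b
  ...       | no ¬Pa | _    = ⊥-elim (∄good (a , a∈C , a-simplicial , ¬Pa))
  ...       | yes _  | no ¬Pb = ⊥-elim (∄good (b , b∈C , b-simplicial , ¬Pb))
  ...       | yes Pa | yes Pb = ⊥-elim (a≢b (P-unique a∈C b∈C Pa Pb))

  module SimplexPartition (unique-simplex : EachVertexInUniqueSimplex G) where

    σ : Fin n → Subset n
    σ u = proj₁ (proj₁ (unique-simplex u))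

    σ-isSimplex : ∀ u → IsSimplex G (σ u)
    σ-isSimplex u = proj₁ (proj₂ (proj₁ (unique-simplex u)))

    u∈σu : ∀ u → u ∈ σ u
    u∈σu u = proj₂ (proj₂ (proj₁ (unique-simplex u)))

    σ-unique : IsSimplex G C → u ∈ C → σ u ≡ C
    σ-unique {u = u} C-simplex u∈C =
      proj₂ (unique-simplex u) _ _ (σ-isSimplex u) C-simplex (u∈σu u) u∈C

    transversal : (Subset n → Fin n) → Subset n
    transversal r = toSubset (λ u → u ≟ r (σ u))

    module _ {X : Subset n} {P : Subset n → Pred (Fin n) 0ℓ} {r : Subset n → Fin n}
             (r-represents : Represents X P r) where
      open IsRepresentative

      private
        T : Subset n
        T = transversal r

        representative : ∀ u → IsRepresentative X (P (σ u)) (σ u) (r (σ u))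
        representative u = r-represents (σ-isSimplex u)

      ∈-transversal⁺ : u ≡ r (σ u) → u ∈ T
      ∈-transversal⁺ = ∈-toSubset⁺ (λ u → u ≟ r (σ u))

      ∈-transversal⁻ : u ∈ T → u ≡ r (σ u)
      ∈-transversal⁻ = ∈-toSubset⁻ (λ u → u ≟ r (σ u))

      σ-representative : ∀ u → σ (r (σ u)) ≡ σ u
      σ-representative u = σ-unique (σ-isSimplex u) (∈C (representative u))

      representative-∈-transversal : ∀ u → r (σ u) ∈ T
      representative-∈-transversal u = ∈-transversal⁺ (cong r (sym (σ-representative u)))

      transversal-unique : x ∈ T → y ∈ T → y ∈ σ x → y ≡ x
      transversal-unique {x} {y} x∈T y∈T y∈σx = begin
        y         ≡⟨ ∈-transversal⁻ y∈T ⟩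
        r (σ y)   ≡⟨ cong r (σ-unique (σ-isSimplex x) y∈σx) ⟩
        r (σ x)   ≡⟨ ∈-transversal⁻ x∈T ⟨
        x         ∎
        where open ≡-Reasoning

      transversal-∈X⊎simplicial : u ∈ T → u ∈ X ⊎ (Simplicial G u × ¬ P (σ u) u)
      transversal-∈X⊎simplicial {u} u∈T =
        subst (λ w → w ∈ X ⊎ (Simplicial G w × ¬ P (σ u) w)) (sym (∈-transversal⁻ u∈T))
          (∈X⊎simplicial (representative u))

      transversal-isolated : u ∈ T → v ∈ T → Simplicial G u → ¬ Adj u v
      transversal-isolated {u} {v} u∈T v∈T u-simplicial u~v =
        irrefl (subst (Adj u) (transversal-unique u∈T v∈T v∈σu) u~v)
        where
        v∈σu : v ∈ σ u
        v∈σu = simplicial-neighbour-∈ (σ-isSimplex u) (u∈σu u) u-simplicial u~v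

      transversal-independent : Independent G X → Independent G T
      transversal-independent X-independent x y x∈T y∈T x~y
        with transversal-∈X⊎simplicial x∈T | transversal-∈X⊎simplicial y∈T
      ... | inj₂ (x-simplicial , _) | _ = transversal-isolated x∈T y∈T x-simplicial x~y
      ... | _ | inj₂ (y-simplicial , _) = transversal-isolated y∈T x∈T y-simplicial (Adj-sym x~y)
      ... | inj₁ x∈X | inj₁ y∈X = X-independent x y x∈X y∈X x~y

      independent-∣∣≤∣transversal∣ : ∀ I → Independent G I → ∣ I ∣ ≤ ∣ T ∣
      independent-∣∣≤∣transversal∣ I I-independent =
        injectiveOn⇒∣p∣≤∣q∣ (λ u → r (σ u)) (λ {u} _ → representative-∈-transversal u) injective
        where
        injective : x ∈ I → y ∈ I → r (σ x) ≡ r (σ y) → x ≡ y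
        injective {x} {y} x∈I y∈I rx≡ry =
          independent-simplex-unique (σ-isSimplex x) I-independent (u∈σu x) y∈σx x∈I y∈I
          where
          σy≡σx : σ y ≡ σ x
          σy≡σx = begin
            σ y            ≡⟨ σ-representative y ⟨
            σ (r (σ y))    ≡⟨ cong σ rx≡ry ⟨
            σ (r (σ x))    ≡⟨ σ-representative x ⟩
            σ x            ∎
            where open ≡-Reasoning
          y∈σx : y ∈ σ x
          y∈σx = subst (y ∈_) σy≡σx (u∈σu y)

      transversal-maximumIndependent : Independent G X → MaximumIndependent G T
      transversal-maximumIndependent X-independent =
        transversal-independent X-independent , independent-∣∣≤∣transversal∣

      ⊆-transversal : Independent G X → X ⊆ T
      ⊆-transversal X-independent {x} x∈X = ∈-transversal⁺
        (independent-simplex-unique (σ-isSimplex x) X-independent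
          (u∈σu x) (∈C (representative x)) x∈X (∈X-if-meets (representative x) (u∈σu x) x∈X))

    transversals-disjoint : {A B : Subset n} {rA rB : Subset n → Fin n} →
      Represents A (λ _ → _∈ B) rA → Represents B (λ C → _≡ rA C) rB →
      Disjoint G A B → Disjoint G (transversal rA) (transversal rB)
    transversals-disjoint rA-represents rB-represents A∩B≡∅ x x∈SA x∈SB
      with transversal-∈X⊎simplicial rA-represents x∈SA
         | transversal-∈X⊎simplicial rB-represents x∈SB
    ... | _              | inj₂ (_ , x≢rA) = x≢rA (∈-transversal⁻ rA-represents x∈SA)
    ... | inj₁ x∈A       | inj₁ x∈B = A∩B≡∅ x x∈A x∈B
    ... | inj₂ (_ , x∉B) | inj₁ x∈B = x∉B x∈B

proposition3p8 : (n : ℕ) → .{{_ : NonZero n}} → (G : Graph n) →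
    EachVertexInUniqueSimplex G → SimplicesHaveTwoSimplicial G → InW₂ G
proposition3p8 (suc m) G unique-simplex two-simplicial A B A-independent B-independent A∩B≡∅ =
  transversal rA , transversal rB ,
  transversal-maximumIndependent rA-represents A-independent ,
  transversal-maximumIndependent rB-represents B-independent ,
  ⊆-transversal rA-represents A-independent ,
  ⊆-transversal rB-represents B-independent ,
  transversals-disjoint rA-represents rB-represents A∩B≡∅
  where
  open SimplexPartition G unique-simplex

  rA rB : Subset (suc m) → Fin (suc m)
  rA = pick G A (_∈? B) zero
  rB C = pick G B (_≟ rA C) zero C

  rA-represents : Represents G A (λ _ → _∈ B) rA
  rA-represents C-simplex = pick-isRepresentative G two-simplicial C-simplex (_∈? B) zero
    (λ x∈C y∈C → independent-simplex-unique G C-simplex B-independent x∈C y∈C)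

  rB-represents : Represents G B (λ C → _≡ rA C) rB
  rB-represents {C} C-simplex = pick-isRepresentative G two-simplicial C-simplex (_≟ rA C) zero
    (λ _ _ x≡rA y≡rA → trans x≡rA (sym y≡rA))
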